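{- Let $k\ge1$ and let $\bar P_{(k,k)}$ be the poset on $\{a_1,\dots,a_k,b_1,\dots,b_k\}$ generated by the cover relations $a_{j+1}\prec a_j$ for $1\le j\le k-1$ and $b_j\prec a_j$ for $1\le j\le k$. Then \[ \mathrm{Ehr}(\mathcal{O}(\bar P_{(k,k)}),x)=\frac{\sum_{i=1}^kT(k,i)x^{i-1}}{(1-x)^{2k+1}}, \] where $T(k,i)$, $1\le i\le k$, is the second-order Eulerian triangle, defined by $T(1,1)=1$, $T(m,i)=0$ unless $1\le i\le m$, and $T(m,i)=i\,T(m-1,i)+(2m-i)\,T(m-1,i-1)$ for $m\ge2$.
   Context: For a finite poset $P$, the order polytope $\mathcal{O}(P)\subset\mathbb{R}^P$ is defined by $0\le x_s\le1$ and $x_s\le x_{s'}$ whenever $s\prec s'$; $\mathrm{ehr}(\mathcal{O}(P),n)=|n\mathcal{O}(P)\cap\mathbb{Z}^P|$ for $n\ge1$, and $\mathrm{Ehr}(\mathcal{O}(P),x)=1+\sum_{n\ge1}\mathrm{ehr}(\mathcal{O}(P),n)x^n$. The second-order Eulerian triangle (OEIS A008517) has rows $1$; $1,2$; $1,8,6$; $1,22,58,24$; $\dots$ -}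

module Defs where

open import Data.Nat using (ℕ; zero; suc; _+_; _*_; _∸_; _≤_; _≤ᵇ_)
open import Data.Nat.Combinatorics using (_C_)
open import Data.Fin using (Fin; toℕ)
open import Data.Bool using (if_then_else_)
open import Data.Product using (Σ; _×_; proj₁)
open import Data.Integer as ℤ using (ℤ)
open import Level using (0ℓ)
open import Relation.Binary.Bundles using (Setoid)
open import Relation.Binary.PropositionalEquality as ≡ using (_≡_)
open import Relation.Binary.Construct.Closure.Transitive using (TransClosure)
open import Function.Bundles using (Inverse)

-- Ground set of P̄_(k,k): a_1..a_k, b_1..b_k (index j : Fin k stands for j+1).
data El (k : ℕ) : Set where
  a : Fin k → El k
  b : Fin k → El k

data Cover (k : ℕ) : El k → El k → Set where
  aa : (i j : Fin k) → toℕ i ≡ suc (toℕ j) → Cover k (a i) (a j)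
  ba : (j : Fin k) → Cover k (b j) (a j)

_≺_ : {k : ℕ} → El k → El k → Set
_≺_ {k} = TransClosure (Cover k)

-- Lattice points of n·O(P̄_(k,k)): x ∈ ℤ^P with 0 ≤ x_s ≤ n, x_s ≤ x_t when s ≺ t
-- (nonnegative integers represented by ℕ); equality is pointwise.
LatticePoints : (k n : ℕ) → Setoid 0ℓ 0ℓ
LatticePoints k n = record
  { Carrier = Σ (El k → ℕ) (λ x → ((s : El k) → x s ≤ n) × ((s t : El k) → s ≺ t → x s ≤ x t))
  ; _≈_ = λ p q → (s : El k) → proj₁ p s ≡ proj₁ q s
  ; isEquivalence = record
    { refl = λ s → ≡.refl
    ; sym = λ e s → ≡.sym (e s)
    ; trans = λ e f s → ≡.trans (e s) (f s) } }

HasCard : Setoid 0ℓ 0ℓ → ℕ → Set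
HasCard S m = Inverse (≡.setoid (Fin m)) S

-- Coefficients of Ehr(x) = 1 + Σ_{n≥1} ehr(n) x^n, given ehr as e.
EhrCoeff : (ℕ → ℕ) → ℕ → ℕ
EhrCoeff e zero = 1
EhrCoeff e (suc n) = e (suc n)

T : ℕ → ℕ → ℕ
T zero i = 0
T (suc zero) zero = 0
T (suc zero) (suc zero) = 1
T (suc zero) (suc (suc i)) = 0
T (suc (suc m)) zero = 0
T (suc (suc m)) (suc i) =
  if suc i ≤ᵇ suc (suc m)
  then suc i * T (suc m) (suc i) + (2 * suc (suc m) ∸ suc i) * T (suc m) i
  else 0

sumTo : ℕ → (ℕ → ℤ) → ℤ
sumTo zero f = f 0
sumTo (suc n) f = sumTo n f ℤ.+ f (suc n)

sign : ℕ → ℤ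
sign zero = ℤ.+ 1
sign (suc j) = ℤ.- sign j

mulOneMinusXPow : ℕ → (ℕ → ℕ) → ℕ → ℤ
mulOneMinusXPow d A n = sumTo n (λ j → sign j ℤ.* ℤ.+ (d C j) ℤ.* ℤ.+ A (n ∸ j))

{-# OPTIONS --safe #-}

-- Let E_k(n) count the lattice points of n·O(P̄_(k,k)). Splitting on the value of x at the
-- top element a₁ gives E_k(n) = E_k(n-1) + (n+1)·E_{k-1}(n): if x(a₁) = n, then x(b₁) is
-- any of 0..n and the remaining coordinates form a point of n·O(P̄_(k-1,k-1)). On coefficient
-- sequences, multiplication by 1 - x is the backward difference Δ, so Δ E_k = D E_{k-1} with
-- (D u)(n) = (n+1)·u(n). The commutation rule Δ^(m+1) D = D Δ^(m+1) + (m+1)·S Δ^m, S the shift,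
-- then gives U_k = D (Δ U_{k-1}) + 2k·S U_{k-1} for U_k = Δ^(2k+1) E_k, and this is exactly the
-- recurrence T(k,i) = i·T(k-1,i) + (2k-i)·T(k-1,i-1) read on the sequence n ↦ T(k,n+1).

module Submission where

open import Defs
open import Data.Nat using (ℕ; zero; suc)
open import Data.Integer using (ℤ; +_)
open import Function.Base using (_∘_)
open import Relation.Binary.PropositionalEquality
  using (_≡_; _≗_; refl; sym; trans; cong; cong₂; module ≡-Reasoning)

module FiniteDifferences where

  open import Data.Integer using (_+_; _-_; _*_; -_)
  import Data.Integer.Properties as ℤ
  open import Data.Integer.Tactic.RingSolver using (solve-∀)
  open import Data.Nat using (_∸_)
  open import Data.Nat.Combinatorics using (_C_; nCk+nC[k+1]≡[n+1]C[k+1])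
  open ≡-Reasoning

  -- On coefficient sequences of power series, shift is multiplication by x,
  -- Δ by 1 - x, and D is F ↦ (x·F)′.
  shift : (ℕ → ℤ) → ℕ → ℤ
  shift u zero = + 0
  shift u (suc n) = u n

  Δ : (ℕ → ℤ) → ℕ → ℤ
  Δ u n = u n - shift u n

  Δ^ : ℕ → (ℕ → ℤ) → ℕ → ℤ
  Δ^ zero u = u
  Δ^ (suc d) u = Δ (Δ^ d u)

  D : (ℕ → ℤ) → ℕ → ℤ
  D u n = + suc n * u n

  shift-cong : ∀ {u v} → u ≗ v → shift u ≗ shift v
  shift-cong e zero = refl
  shift-cong e (suc n) = e n

  Δ-cong : ∀ {u v} → u ≗ v → Δ u ≗ Δ v
  Δ-cong e n = cong₂ _-_ (e n) (shift-cong e n)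

  Δ^-cong : ∀ d {u v} → u ≗ v → Δ^ d u ≗ Δ^ d v
  Δ^-cong zero e = e
  Δ^-cong (suc d) e = Δ-cong (Δ^-cong d e)

  Δ^-suc : ∀ d u → Δ^ (suc d) u ≗ Δ^ d (Δ u)
  Δ^-suc zero u n = refl
  Δ^-suc (suc d) u = Δ-cong (Δ^-suc d u)

  sumTo-head : ∀ n f → sumTo (suc n) f ≡ f 0 + sumTo n (f ∘ suc)
  sumTo-head zero f = refl
  sumTo-head (suc n) f = begin
    sumTo (suc n) f + f (suc (suc n))
      ≡⟨ cong (_+ f (suc (suc n))) (sumTo-head n f) ⟩
    f 0 + sumTo n (f ∘ suc) + f (suc (suc n))
      ≡⟨ ℤ.+-assoc (f 0) (sumTo n (f ∘ suc)) (f (suc (suc n))) ⟩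
    f 0 + sumTo (suc n) (f ∘ suc) ∎

  sumTo-cong : ∀ n {f g} → f ≗ g → sumTo n f ≡ sumTo n g
  sumTo-cong zero e = e 0
  sumTo-cong (suc n) e = cong₂ _+_ (sumTo-cong n e) (e (suc n))

  sumTo-zeros : ∀ n → sumTo n (λ _ → + 0) ≡ + 0
  sumTo-zeros zero = refl
  sumTo-zeros (suc n) = cong (_+ + 0) (sumTo-zeros n)

  sumTo-minus : ∀ n f g → sumTo n (λ j → f j - g j) ≡ sumTo n f - sumTo n g
  sumTo-minus zero f g = refl
  sumTo-minus (suc n) f g = begin
    sumTo n (λ j → f j - g j) + (f (suc n) - g (suc n))
      ≡⟨ cong (_+ (f (suc n) - g (suc n))) (sumTo-minus n f g) ⟩
    sumTo n f - sumTo n g + (f (suc n) - g (suc n))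
      ≡⟨ interchange (sumTo n f) (sumTo n g) (f (suc n)) (g (suc n)) ⟩
    sumTo n f + f (suc n) - (sumTo n g + g (suc n)) ∎
    where
    interchange : ∀ a b c d → a - b + (c - d) ≡ a + c - (b + d)
    interchange = solve-∀

  mulOneMinusXPow-zero : ∀ A → mulOneMinusXPow 0 A ≗ +_ ∘ A
  mulOneMinusXPow-zero A zero = ℤ.*-identityˡ (+ A 0)
  mulOneMinusXPow-zero A (suc n) = begin
    sumTo (suc n) (λ j → sign j * + (0 C j) * + A (suc n ∸ j))
      ≡⟨ sumTo-head n _ ⟩
    + 1 * + 1 * + A (suc n) + sumTo n (λ j → sign (suc j) * + 0 * + A (n ∸ j))
      ≡⟨ cong₂ _+_ (ℤ.*-identityˡ (+ A (suc n))) (trans (sumTo-cong n vanish) (sumTo-zeros n)) ⟩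
    + A (suc n) + + 0
      ≡⟨ ℤ.+-identityʳ (+ A (suc n)) ⟩
    + A (suc n) ∎
    where
    vanish : ∀ j → sign (suc j) * + 0 * + A (n ∸ j) ≡ + 0
    vanish j = trans (cong (_* + A (n ∸ j)) (ℤ.*-zeroʳ (sign (suc j)))) (ℤ.*-zeroˡ (+ A (n ∸ j)))

  mulOneMinusXPow-suc : ∀ d A → mulOneMinusXPow (suc d) A ≗ Δ (mulOneMinusXPow d A)
  mulOneMinusXPow-suc d A zero = sym (ℤ.+-identityʳ (+ 1 * + 1 * + A 0))
  mulOneMinusXPow-suc d A (suc n) = begin
    sumTo (suc n) (λ j → sign j * + (suc d C j) * + A (suc n ∸ j))
      ≡⟨ sumTo-head n _ ⟩
    lead + sumTo n (λ j → sign (suc j) * + (suc d C suc j) * + A (n ∸ j))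
      ≡⟨ cong (λ t → lead + t) (sumTo-cong n pascal) ⟩
    lead + sumTo n (λ j → term (suc n) (suc j) - term n j)
      ≡⟨ cong (λ t → lead + t) (sumTo-minus n (term (suc n) ∘ suc) (term n)) ⟩
    lead + (sumTo n (term (suc n) ∘ suc) - sumTo n (term n))
      ≡⟨ sym (ℤ.+-assoc lead _ _) ⟩
    lead + sumTo n (term (suc n) ∘ suc) - sumTo n (term n)
      ≡⟨ cong (_- sumTo n (term n)) (sym (sumTo-head n (term (suc n)))) ⟩
    Δ (mulOneMinusXPow d A) (suc n) ∎
    where
    term : ℕ → ℕ → ℤ
    term m j = sign j * + (d C j) * + A (m ∸ j)
    lead = + 1 * + 1 * + A (suc n)
    pascal : ∀ j → sign (suc j) * + (suc d C suc j) * + A (n ∸ j) ≡ term (suc n) (suc j) - term n j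
    pascal j = begin
      - sign j * + (suc d C suc j) * + A (n ∸ j)
        ≡⟨ cong (λ c → - sign j * c * + A (n ∸ j)) pascal-ℤ ⟩
      - sign j * (+ (d C j) + + (d C suc j)) * + A (n ∸ j)
        ≡⟨ split (sign j) (+ (d C j)) (+ (d C suc j)) (+ A (n ∸ j)) ⟩
      term (suc n) (suc j) - term n j ∎
      where
      pascal-ℤ : + (suc d C suc j) ≡ + (d C j) + + (d C suc j)
      pascal-ℤ = trans (cong +_ (sym (nCk+nC[k+1]≡[n+1]C[k+1] d j))) (ℤ.pos-+ (d C j) (d C suc j))
      split : ∀ s c c′ a → - s * (c + c′) * a ≡ - s * c′ * a - s * c * a
      split = solve-∀

  mulOneMinusXPow≡Δ^ : ∀ d A → mulOneMinusXPow d A ≗ Δ^ d (+_ ∘ A)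
  mulOneMinusXPow≡Δ^ zero A = mulOneMinusXPow-zero A
  mulOneMinusXPow≡Δ^ (suc d) A n =
    trans (mulOneMinusXPow-suc d A n) (Δ-cong (mulOneMinusXPow≡Δ^ d A) n)

  Δ-shift : ∀ u → Δ (shift u) ≗ shift (Δ u)
  Δ-shift u zero = refl
  Δ-shift u (suc n) = refl

  shift-linear : ∀ c u v → shift (λ n → u n + c * v n) ≗ λ n → shift u n + c * shift v n
  shift-linear c u v zero = sym (trans (ℤ.+-identityˡ (c * + 0)) (ℤ.*-zeroʳ c))
  shift-linear c u v (suc n) = refl

  Δ-linear : ∀ c u v → Δ (λ n → u n + c * v n) ≗ λ n → Δ u n + c * Δ v n
  Δ-linear c u v n = begin
    u n + c * v n - shift (λ i → u i + c * v i) n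
      ≡⟨ cong (λ t → u n + c * v n - t) (shift-linear c u v n) ⟩
    u n + c * v n - (shift u n + c * shift v n)
      ≡⟨ distrib (u n) (v n) (shift u n) (shift v n) c ⟩
    Δ u n + c * Δ v n ∎
    where
    distrib : ∀ x y x′ y′ c → x + c * y - (x′ + c * y′) ≡ (x - x′) + c * (y - y′)
    distrib = solve-∀

  Δ-D : ∀ u → Δ (D u) ≗ λ n → D (Δ u) n + shift u n
  Δ-D u zero = unit (u 0)
    where
    unit : ∀ x → + 1 * x - + 0 ≡ + 1 * (x - + 0) + + 0
    unit = solve-∀
  Δ-D u (suc n) = leibniz (+ suc n) (u (suc n)) (u n)
    where
    leibniz : ∀ N x y → (+ 1 + N) * x - N * y ≡ (+ 1 + N) * (x - y) + y
    leibniz = solve-∀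

  Δ^-D : ∀ m u → Δ^ (suc m) (D u) ≗ λ n → D (Δ^ (suc m) u) n + + suc m * shift (Δ^ m u) n
  Δ^-D zero u n = trans (Δ-D u n) (cong (λ t → D (Δ u) n + t) (sym (ℤ.*-identityˡ (shift u n))))
  Δ^-D (suc m) u n = begin
    Δ (Δ^ (suc m) (D u)) n
      ≡⟨ Δ-cong (Δ^-D m u) n ⟩
    Δ (λ i → D v i + + suc m * shift w i) n
      ≡⟨ Δ-linear (+ suc m) (D v) (shift w) n ⟩
    Δ (D v) n + + suc m * Δ (shift w) n
      ≡⟨ cong₂ (λ p q → p + + suc m * q) (Δ-D v n) (Δ-shift w n) ⟩
    D (Δ v) n + shift v n + + suc m * shift v n
      ≡⟨ collect (D (Δ v) n) (shift v n) (+ suc m) ⟩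
    D (Δ v) n + + suc (suc m) * shift v n ∎
    where
    v = Δ^ (suc m) u
    w = Δ^ m u
    collect : ∀ a s k → a + s + k * s ≡ a + (+ 1 + k) * s
    collect = solve-∀

module EulerianTriangle where

  open import Data.Nat using (_+_; _*_; _∸_; _≤_; _<_; _≤ᵇ_; s≤s)
  import Data.Nat.Properties as ℕ
  open import Data.Bool using (true; false)
  open import Data.Bool.Properties using (T-≡)
  open import Data.Empty using (⊥-elim)
  open import Function.Bundles using (Equivalence)

  ≤ᵇ-true : ∀ {m n} → m ≤ n → (m ≤ᵇ n) ≡ true
  ≤ᵇ-true = Equivalence.to T-≡ ∘ ℕ.≤⇒≤ᵇ

  ≤ᵇ-false : ∀ {m n} → n < m → (m ≤ᵇ n) ≡ false
  ≤ᵇ-false {m} {n} n<m with m ≤ᵇ n in guard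
  ... | true = ⊥-elim (ℕ.<⇒≱ n<m (ℕ.≤ᵇ⇒≤ m n (Equivalence.from T-≡ guard)))
  ... | false = refl

  T-zero : ∀ m → T m 0 ≡ 0
  T-zero zero = refl
  T-zero (suc zero) = refl
  T-zero (suc (suc m)) = refl

  T-above : ∀ m i → m < i → T m i ≡ 0
  T-above zero i _ = refl
  T-above (suc zero) (suc zero) (s≤s ())
  T-above (suc zero) (suc (suc i)) _ = refl
  T-above (suc (suc m)) (suc i) m<i rewrite ≤ᵇ-false m<i = refl

  T-unfold : ∀ m n → n ≤ suc m →
             T (suc (suc m)) (suc n) ≡ suc n * T (suc m) (suc n) + (2 * suc (suc m) ∸ suc n) * T (suc m) n
  T-unfold m n n≤ rewrite ≤ᵇ-true (s≤s n≤) = refl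

module EulerianRows where

  import Data.Nat as ℕ
  import Data.Nat.Properties as ℕ
  open import Data.Integer using (_+_; _-_; _*_)
  import Data.Integer.Properties as ℤ
  open import Data.Integer.Tactic.RingSolver using (solve-∀)
  open import Relation.Nullary using (yes; no)
  open ≡-Reasoning
  open FiniteDifferences
  open EulerianTriangle

  eulerianRow : ℕ → ℕ → ℤ
  eulerianRow k n = + T k (suc n)

  eulerStep : ℕ → (ℕ → ℤ) → ℕ → ℤ
  eulerStep k u n = D (Δ u) n + + (2 ℕ.* suc k) * shift u n

  eulerStep-cong : ∀ k {u v} → u ≗ v → eulerStep k u ≗ eulerStep k v
  eulerStep-cong k e n =
    cong₂ (λ p q → + suc n * p + + (2 ℕ.* suc k) * q) (Δ-cong e n) (shift-cong e n)

  c*x+[w∸c]*y≡c*[x-y]+w*y : ∀ {c w} x y → c ℕ.≤ w →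
                             + (c ℕ.* x ℕ.+ (w ℕ.∸ c) ℕ.* y) ≡ + c * (+ x - + y) + + w * + y
  c*x+[w∸c]*y≡c*[x-y]+w*y {c} {w} x y c≤w = begin
    + (c ℕ.* x ℕ.+ (w ℕ.∸ c) ℕ.* y)
      ≡⟨ trans (ℤ.pos-+ (c ℕ.* x) _) (cong₂ _+_ (ℤ.pos-* c x) (ℤ.pos-* (w ℕ.∸ c) y)) ⟩
    + c * + x + + (w ℕ.∸ c) * + y
      ≡⟨ cong (λ d → + c * + x + d * + y) (sym (trans (ℤ.[+m]-[+n]≡m⊖n w c) (ℤ.⊖-≥ c≤w))) ⟩
    + c * + x + (+ w - + c) * + y
      ≡⟨ regroup (+ c) (+ w) (+ x) (+ y) ⟩
    + c * (+ x - + y) + + w * + y ∎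
    where
    regroup : ∀ c w x y → c * x + (w - c) * y ≡ c * (x - y) + w * y
    regroup = solve-∀

  T-recurrence : ∀ m n → + T (suc (suc m)) (suc n)
                 ≡ + suc n * (+ T (suc m) (suc n) - + T (suc m) n) + + (2 ℕ.* suc (suc m)) * + T (suc m) n
  T-recurrence m n with n ℕ.≤? suc m
  ... | yes n≤ = trans (cong +_ (T-unfold m n n≤))
                       (c*x+[w∸c]*y≡c*[x-y]+w*y (T (suc m) (suc n)) (T (suc m) n) suc-n≤w)
    where
    suc-n≤w : suc n ℕ.≤ 2 ℕ.* suc (suc m)
    suc-n≤w = ℕ.≤-trans (ℕ.s≤s n≤) (ℕ.m≤m+n (suc (suc m)) _)
  ... | no n≰ = begin
    + T (suc (suc m)) (suc n)
      ≡⟨ cong +_ (T-above (suc (suc m)) (suc n) (ℕ.s≤s m<n)) ⟩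
    + 0
      ≡⟨ sym (cong₂ _+_ (ℤ.*-zeroʳ (+ suc n)) (ℤ.*-zeroʳ (+ (2 ℕ.* suc (suc m))))) ⟩
    + suc n * (+ 0 - + 0) + + (2 ℕ.* suc (suc m)) * + 0
      ≡⟨ sym (cong₂ (λ t₁ t₀ → + suc n * (+ t₁ - + t₀) + + (2 ℕ.* suc (suc m)) * + t₀)
                    (T-above (suc m) (suc n) (ℕ.<-trans m<n (ℕ.n<1+n n))) (T-above (suc m) n m<n)) ⟩
    + suc n * (+ T (suc m) (suc n) - + T (suc m) n) + + (2 ℕ.* suc (suc m)) * + T (suc m) n ∎
    where
    m<n : suc m ℕ.< n
    m<n = ℕ.≰⇒> n≰

  shift-eulerianRow : ∀ k → shift (eulerianRow k) ≗ λ n → + T k n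
  shift-eulerianRow k zero = cong +_ (sym (T-zero k))
  shift-eulerianRow k (suc n) = refl

  eulerianRow-suc : ∀ m → eulerianRow (suc (suc m)) ≗ eulerStep (suc m) (eulerianRow (suc m))
  eulerianRow-suc m n = trans (T-recurrence m n)
    (sym (cong (λ t → + suc n * (eulerianRow (suc m) n - t) + + (2 ℕ.* suc (suc m)) * t)
               (shift-eulerianRow (suc m) n)))

module LatticePointCount where

  open import Data.Nat using (_+_; _*_; _≤_; _≟_; s≤s)
  import Data.Nat.Properties as ℕ
  open import Data.Fin using (Fin; toℕ; fromℕ<) renaming (suc to sucF)
  open import Data.Fin.Patterns using (0F; 1F)
  import Data.Fin.Properties as Fin
  open import Data.Fin.Permutation using (↔⇒≡)
  open import Data.Product using (_×_; _,_; proj₁; proj₂)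
  open import Data.Product.Function.NonDependent.Propositional using (_×-↔_)
  open import Data.Sum using (_⊎_; inj₁; inj₂)
  open import Data.Sum.Function.Propositional using (_⊎-↔_)
  open import Data.Unit using (⊤; tt)
  open import Data.Empty using (⊥-elim)
  open import Relation.Binary.Bundles using (Setoid)
  open import Relation.Binary.Construct.Closure.Transitive using ([_]; _∷_; _∷ʳ_)
  open import Relation.Binary.PropositionalEquality using (_≢_; subst; setoid)
  open import Relation.Nullary using (yes; no)
  open import Function.Bundles using (Inverse; _↔_)
  open ≡-Reasoning
  open import Function.Properties.Inverse using (↔-refl; ↔-trans)
  import Function.Construct.Composition as Composition
  import Function.Construct.Symmetry as Symmetry

  shiftEl : ∀ {k} → El k → El (suc k)
  shiftEl (a j) = a (sucF j)
  shiftEl (b j) = b (sucF j)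

  Cover-shift : ∀ {k s t} → Cover k s t → Cover (suc k) (shiftEl s) (shiftEl t)
  Cover-shift (aa i j i≡1+j) = aa (sucF i) (sucF j) (cong suc i≡1+j)
  Cover-shift (ba j) = ba (sucF j)

  ≺-shift : ∀ {k} {s t : El k} → s ≺ t → shiftEl s ≺ shiftEl t
  ≺-shift [ c ] = [ Cover-shift c ]
  ≺-shift (c ∷ p) = Cover-shift c ∷ ≺-shift p

  a≺a₀ : ∀ {k} (i : Fin k) → a (sucF i) ≺ a {suc k} 0F
  a≺a₀ 0F = [ aa 1F 0F refl ]
  a≺a₀ (sucF i) = ≺-shift (a≺a₀ i) ∷ʳ aa 1F 0F refl

  Bounded : ∀ {k} → ℕ → (El k → ℕ) → Set
  Bounded {k} n x = (s : El k) → x s ≤ n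

  Monotone : ∀ {k} → (El k → ℕ) → Set
  Monotone {k} x = (s t : El k) → s ≺ t → x s ≤ x t

  monotone-from-covers : ∀ {k} {x : El k → ℕ} →
                         ((s t : El k) → Cover k s t → x s ≤ x t) → Monotone x
  monotone-from-covers mono s t [ c ] = mono s t c
  monotone-from-covers mono s t (c ∷ p) = ℕ.≤-trans (mono _ _ c) (monotone-from-covers mono _ t p)

  top-maximal : ∀ {k} {x : El (suc k) → ℕ} → Monotone x → (s : El (suc k)) → x s ≤ x (a 0F)
  top-maximal mono (a 0F) = ℕ.≤-refl
  top-maximal mono (a (sucF i)) = mono _ _ (a≺a₀ i)
  top-maximal mono (b 0F) = mono _ _ [ ba 0F ]
  top-maximal mono (b (sucF i)) = mono _ _ (ba (sucF i) ∷ a≺a₀ i)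

  prepend : ∀ {k} → ℕ → ℕ → (El k → ℕ) → El (suc k) → ℕ
  prepend y z x (a 0F) = y
  prepend y z x (b 0F) = z
  prepend y z x (a (sucF j)) = x (a j)
  prepend y z x (b (sucF j)) = x (b j)

  prepend-bounded : ∀ {k n y z} {x : El k → ℕ} →
                    z ≤ y → y ≤ n → Bounded y x → Bounded n (prepend y z x)
  prepend-bounded z≤y y≤n x≤y (a 0F) = y≤n
  prepend-bounded z≤y y≤n x≤y (b 0F) = ℕ.≤-trans z≤y y≤n
  prepend-bounded z≤y y≤n x≤y (a (sucF j)) = ℕ.≤-trans (x≤y (a j)) y≤n
  prepend-bounded z≤y y≤n x≤y (b (sucF j)) = ℕ.≤-trans (x≤y (b j)) y≤n

  prepend-monotone : ∀ {k y z} {x : El k → ℕ} →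
                     z ≤ y → Bounded y x → Monotone x → Monotone (prepend y z x)
  prepend-monotone {y = y} {z} {x} z≤y x≤y mono = monotone-from-covers covers
    where
    covers : ∀ s t → Cover _ s t → prepend y z x s ≤ prepend y z x t
    covers _ _ (aa (sucF i) 0F _) = x≤y (a i)
    covers _ _ (aa (sucF i) (sucF j) i≡1+j) = mono _ _ [ aa i j (ℕ.suc-injective i≡1+j) ]
    covers _ _ (ba 0F) = z≤y
    covers _ _ (ba (sucF j)) = mono _ _ [ ba j ]

  Point : ℕ → ℕ → Set
  Point k n = Setoid.Carrier (LatticePoints k n)

  _≈_ : ∀ {k n} → Point k n → Point k n → Set
  _≈_ {k} {n} = Setoid._≈_ (LatticePoints k n)

  tail : ∀ {k n} → Point (suc k) n → Point k n
  tail (x , x≤n , mono) = x ∘ shiftEl , x≤n ∘ shiftEl , λ s t s≺t → mono _ _ (≺-shift s≺t)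

  weaken : ∀ {k n} → Point k n → Point k (suc n)
  weaken (x , x≤n , mono) = x , (λ s → ℕ.m≤n⇒m≤1+n (x≤n s)) , mono

  lower : ∀ {k n} (p : Point (suc k) (suc n)) → proj₁ p (a 0F) ≢ suc n → Point (suc k) n
  lower (x , x≤1+n , mono) top≢ = x , (λ s → ℕ.≤-trans (top-maximal mono s) top≤n) , mono
    where top≤n = ℕ.≤-pred (ℕ.≤∧≢⇒< (x≤1+n (a 0F)) top≢)

  extend : ∀ {k y} → Fin (suc y) → Point k y → Point (suc k) y
  extend {y = y} z (x , x≤y , mono) =
    prepend y (toℕ z) x , prepend-bounded z≤y ℕ.≤-refl x≤y , prepend-monotone z≤y x≤y mono
    where z≤y = Fin.toℕ≤pred[n] z

  tail-extend : ∀ {k y} (z : Fin (suc y)) (p : Point k y) → tail (extend z p) ≈ p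
  tail-extend z p (a j) = refl
  tail-extend z p (b j) = refl

  extend-tail : ∀ {k n} (p : Point (suc k) n) (z : Fin (suc n)) (q : Point k n) →
                proj₁ p (a 0F) ≡ n → toℕ z ≡ proj₁ p (b 0F) → q ≈ tail p → extend z q ≈ p
  extend-tail p z q top≡ z≡ q≈ (a 0F) = sym top≡
  extend-tail p z q top≡ z≡ q≈ (b 0F) = z≡
  extend-tail p z q top≡ z≡ q≈ (a (sucF j)) = q≈ (a j)
  extend-tail p z q top≡ z≡ q≈ (b (sucF j)) = q≈ (b j)

  -- Codes for the points of n·O(P̄_(k,k)), split by whether x(a₁) < n or x(a₁) = n;
  -- in the second case x(b₁) and a point on the remaining elements are free.
  Code : ℕ → ℕ → Set
  Code zero n = ⊤
  Code (suc k) zero = Code k zero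
  Code (suc k) (suc n) = Code (suc k) n ⊎ (Fin (suc (suc n)) × Code k (suc n))

  ehrhart : ℕ → ℕ → ℕ
  ehrhart zero n = 1
  ehrhart (suc k) zero = ehrhart k zero
  ehrhart (suc k) (suc n) = ehrhart (suc k) n + suc (suc n) * ehrhart k (suc n)

  ehrhart-zero : ∀ k → ehrhart k 0 ≡ 1
  ehrhart-zero zero = refl
  ehrhart-zero (suc k) = ehrhart-zero k

  Fin↔Code : ∀ k n → Fin (ehrhart k n) ↔ Code k n
  Fin↔Code zero n = Fin.1↔⊤
  Fin↔Code (suc k) zero = Fin↔Code k zero
  Fin↔Code (suc k) (suc n) =
    ↔-trans Fin.+↔⊎ (Fin↔Code (suc k) n ⊎-↔ ↔-trans Fin.*↔× (↔-refl ×-↔ Fin↔Code k (suc n)))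

  decode : ∀ k n → Code k n → Point k n
  decode zero n tt = (λ { (a ()) ; (b ()) }) , (λ { (a ()) ; (b ()) }) , λ { (a ()) ; (b ()) }
  decode (suc k) zero c = extend 0F (decode k zero c)
  decode (suc k) (suc n) (inj₁ c) = weaken (decode (suc k) n c)
  decode (suc k) (suc n) (inj₂ (z , c)) = extend z (decode k (suc n) c)

  encode : ∀ {k n} → Point k n → Code k n
  encode {zero} p = tt
  encode {suc k} {zero} p = encode (tail p)
  encode {suc k} {suc n} p with proj₁ p (a 0F) ≟ suc n
  ... | yes _ = inj₂ (fromℕ< (s≤s (proj₁ (proj₂ p) (b 0F))) , encode (tail p))
  ... | no top≢ = inj₁ (encode (lower p top≢))

  decode-encode : ∀ {k n} (p : Point k n) → decode k n (encode p) ≈ p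
  decode-encode {zero} p (a ())
  decode-encode {zero} p (b ())
  decode-encode {suc k} {zero} p@(x , x≤0 , _) =
    extend-tail p 0F (decode k zero (encode (tail p)))
                (ℕ.n≤0⇒n≡0 (x≤0 (a 0F))) (sym (ℕ.n≤0⇒n≡0 (x≤0 (b 0F)))) (decode-encode (tail p))
  decode-encode {suc k} {suc n} p with proj₁ p (a 0F) ≟ suc n
  ... | yes top≡ = extend-tail p _ (decode k (suc n) (encode (tail p)))
                               top≡ (Fin.toℕ-fromℕ< _) (decode-encode (tail p))
  ... | no top≢ = decode-encode (lower p top≢)

  encode-cong : ∀ {k n} (p q : Point k n) → p ≈ q → encode p ≡ encode q
  encode-cong {zero} p q p≈q = refl
  encode-cong {suc k} {zero} p q p≈q = encode-cong (tail p) (tail q) (p≈q ∘ shiftEl)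
  encode-cong {suc k} {suc n} p q p≈q with proj₁ p (a 0F) ≟ suc n | proj₁ q (a 0F) ≟ suc n
  ... | yes _ | yes _ = cong inj₂ (cong₂ _,_ (Fin.fromℕ<-cong _ _ (p≈q (b 0F)) _ _)
                                             (encode-cong (tail p) (tail q) (p≈q ∘ shiftEl)))
  ... | yes p≡ | no q≢ = ⊥-elim (q≢ (trans (sym (p≈q (a 0F))) p≡))
  ... | no p≢ | yes q≡ = ⊥-elim (p≢ (trans (p≈q (a 0F)) q≡))
  ... | no p≢ | no q≢ = cong inj₁ (encode-cong (lower p p≢) (lower q q≢) p≈q)

  encode-top : ∀ {k n} (p : Point (suc k) (suc n)) (top≡ : proj₁ p (a 0F) ≡ suc n) →
               encode p ≡ inj₂ (fromℕ< (s≤s (proj₁ (proj₂ p) (b 0F))) , encode (tail p))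
  encode-top {n = n} p top≡ with proj₁ p (a 0F) ≟ suc n
  ... | yes _ = refl
  ... | no top≢ = ⊥-elim (top≢ top≡)

  encode-below : ∀ {k n} (p : Point (suc k) (suc n)) (top≢ : proj₁ p (a 0F) ≢ suc n) →
                 encode p ≡ inj₁ (encode (lower p top≢))
  encode-below {n = n} p top≢ with proj₁ p (a 0F) ≟ suc n
  ... | yes top≡ = ⊥-elim (top≢ top≡)
  ... | no top≢′ = cong inj₁ (encode-cong (lower p top≢′) (lower p top≢) (λ s → refl))

  encode-decode : ∀ k n (c : Code k n) → encode (decode k n c) ≡ c
  encode-decode zero n tt = refl
  encode-decode (suc k) zero c =
    trans (encode-cong _ _ (tail-extend 0F (decode k zero c))) (encode-decode k zero c)
  encode-decode (suc k) (suc n) (inj₁ c) = begin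
    encode (weaken p)                ≡⟨ encode-below (weaken p) top≢ ⟩
    inj₁ (encode (lower (weaken p) top≢)) ≡⟨ cong inj₁ (encode-cong _ p (λ s → refl)) ⟩
    inj₁ (encode p)                 ≡⟨ cong inj₁ (encode-decode (suc k) n c) ⟩
    inj₁ c ∎
    where
    p = decode (suc k) n c
    top≢ : proj₁ p (a 0F) ≢ suc n
    top≢ top≡ = ℕ.1+n≰n (subst (_≤ n) top≡ (proj₁ (proj₂ p) (a 0F)))
  encode-decode (suc k) (suc n) (inj₂ (z , c)) = trans (encode-top (extend z p) refl)
    (cong inj₂ (cong₂ _,_ (Fin.toℕ-injective (Fin.toℕ-fromℕ< _))
                          (trans (encode-cong _ p (tail-extend z p)) (encode-decode k (suc n) c))))
    where
    p = decode k (suc n) c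

  Code↔Point : ∀ k n → Inverse (setoid (Code k n)) (LatticePoints k n)
  Code↔Point k n = record
    { to = decode k n
    ; from = encode
    ; to-cong = λ { refl s → refl }
    ; from-cong = λ {p} {q} → encode-cong p q
    ; inverse = (λ { {p} refl → decode-encode p })
              , (λ {c} {p} p≈ → trans (encode-cong p (decode k n c) p≈) (encode-decode k n c))
    }

  latticePoints-card : ∀ k n → HasCard (LatticePoints k n) (ehrhart k n)
  latticePoints-card k n = Composition.inverse (Fin↔Code k n) (Code↔Point k n)

  HasCard-unique : ∀ {S m m′} → HasCard S m → HasCard S m′ → m ≡ m′
  HasCard-unique I J = ↔⇒≡ (Composition.inverse I (Symmetry.inverse J))

module EhrhartDifferences where

  import Data.Nat as ℕ
  import Data.Nat.Properties as ℕ
  open import Data.Integer using (_+_; _-_; _*_)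
  import Data.Integer.Properties as ℤ
  open import Data.Integer.Tactic.RingSolver using (solve-∀)
  open ≡-Reasoning
  open FiniteDifferences
  open EulerianRows
  open LatticePointCount using (ehrhart)

  Δ-ehrhart : ∀ k → Δ (+_ ∘ ehrhart (suc k)) ≗ D (+_ ∘ ehrhart k)
  Δ-ehrhart k zero = unit (+ ehrhart k 0)
    where
    unit : ∀ x → x - + 0 ≡ + 1 * x
    unit = solve-∀
  Δ-ehrhart k (suc n) = begin
    + (e ℕ.+ new) - + e   ≡⟨ cong (_- + e) (ℤ.pos-+ e new) ⟩
    + e + + new - + e     ≡⟨ cancel (+ e) (+ new) ⟩
    + new                 ≡⟨ ℤ.pos-* (suc (suc n)) (ehrhart k (suc n)) ⟩
    D (+_ ∘ ehrhart k) (suc n) ∎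
    where
    e = ehrhart (suc k) n
    new = suc (suc n) ℕ.* ehrhart k (suc n)
    cancel : ∀ x y → x + y - x ≡ y
    cancel = solve-∀

  Δ^-ehrhart-suc : ∀ k → Δ^ (2 ℕ.* suc k ℕ.+ 1) (+_ ∘ ehrhart (suc k))
                         ≗ eulerStep k (Δ^ (2 ℕ.* k ℕ.+ 1) (+_ ∘ ehrhart k))
  Δ^-ehrhart-suc k n = begin
    Δ^ (2 ℕ.* suc k ℕ.+ 1) E′ n        ≡⟨ cong (λ m → Δ^ (m ℕ.+ 1) E′ n) (ℕ.*-suc 2 k) ⟩
    Δ^ (suc (suc d)) E′ n             ≡⟨ Δ^-suc (suc d) E′ n ⟩
    Δ^ (suc d) (Δ E′) n               ≡⟨ Δ^-cong (suc d) (Δ-ehrhart k) n ⟩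
    Δ^ (suc d) (D E) n                ≡⟨ Δ^-D d E n ⟩
    D (Δ^ (suc d) E) n + + suc d * shift (Δ^ d E) n
      ≡⟨ cong (λ m → D (Δ^ (suc d) E) n + + m * shift (Δ^ d E) n) suc-d≡ ⟩
    eulerStep k (Δ^ d E) n ∎
    where
    d = 2 ℕ.* k ℕ.+ 1
    E = +_ ∘ ehrhart k
    E′ = +_ ∘ ehrhart (suc k)
    suc-d≡ : suc d ≡ 2 ℕ.* suc k
    suc-d≡ = trans (cong suc (ℕ.+-comm (2 ℕ.* k) 1)) (sym (ℕ.*-suc 2 k))

  Δ^-ehrhart : ∀ m → Δ^ (2 ℕ.* suc m ℕ.+ 1) (+_ ∘ ehrhart (suc m)) ≗ eulerianRow (suc m)
  Δ^-ehrhart zero n = trans (Δ^-ehrhart-suc 0 n) (base n)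
    where
    -- Row 0 of T vanishes, so the induction starts at k = 1, where Δ³ E₁ and row 1 both equal δ₀.
    base : eulerStep 0 (Δ (+_ ∘ ehrhart 0)) ≗ eulerianRow 1
    base zero = refl
    base (suc zero) = refl
    base (suc (suc n)) = cong (_+ + 0) (ℤ.*-zeroʳ (+ suc (suc (suc n))))
  Δ^-ehrhart (suc m) n = begin
    Δ^ (2 ℕ.* suc (suc m) ℕ.+ 1) (+_ ∘ ehrhart (suc (suc m))) n
      ≡⟨ Δ^-ehrhart-suc (suc m) n ⟩
    eulerStep (suc m) (Δ^ (2 ℕ.* suc m ℕ.+ 1) (+_ ∘ ehrhart (suc m))) n
      ≡⟨ eulerStep-cong (suc m) (Δ^-ehrhart m) n ⟩
    eulerStep (suc m) (eulerianRow (suc m)) n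
      ≡⟨ sym (eulerianRow-suc m n) ⟩
    eulerianRow (suc (suc m)) n ∎

open import Data.Nat using (_+_; _*_; _≤_; s≤s; z≤n)
open FiniteDifferences using (Δ^; Δ^-cong; mulOneMinusXPow≡Δ^)
open LatticePointCount using (ehrhart; ehrhart-zero; latticePoints-card; HasCard-unique)
open EhrhartDifferences using (Δ^-ehrhart)
open ≡-Reasoning

theorem6p2 : (k : ℕ) → 1 ≤ k → (ehr : ℕ → ℕ) →
    ((n : ℕ) → 1 ≤ n → HasCard (LatticePoints k n) (ehr n)) →
    (n : ℕ) → mulOneMinusXPow (2 * k + 1) (EhrCoeff ehr) n ≡ + T k (suc n)
theorem6p2 (suc m) _ ehr card n = begin
  mulOneMinusXPow (2 * suc m + 1) (EhrCoeff ehr) n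
    ≡⟨ mulOneMinusXPow≡Δ^ (2 * suc m + 1) (EhrCoeff ehr) n ⟩
  Δ^ (2 * suc m + 1) (+_ ∘ EhrCoeff ehr) n
    ≡⟨ Δ^-cong (2 * suc m + 1) (cong +_ ∘ ehr≗ehrhart) n ⟩
  Δ^ (2 * suc m + 1) (+_ ∘ ehrhart (suc m)) n
    ≡⟨ Δ^-ehrhart m n ⟩
  + T (suc m) (suc n) ∎
  where
  ehr≗ehrhart : EhrCoeff ehr ≗ ehrhart (suc m)
  ehr≗ehrhart zero = sym (ehrhart-zero (suc m))
  ehr≗ehrhart (suc i) = HasCard-unique (card (suc i) (s≤s z≤n)) (latticePoints-card (suc m) (suc i))
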